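{- For every integer $n\ge 1$, \[ F_{2n-1}=\sum_{j=0}^{\infty}\bigl[B(n,5j+1)-B(n,5j+4)\bigr]. \]
   Context: $F_n$ denotes the Fibonacci numbers, $F_0=0$, $F_1=1$, $F_{n}=F_{n-1}+F_{n-2}$. Consider lattice paths in $\mathbb{Z}^2$ starting at the origin and consisting of unit steps, each going East or North; the length of a path is its number of steps. The distance between two paths of length $n$ with endpoints $(a,b)$ and $(a',b')$ is $|a-a'|$. Two paths are non-intersecting if the origin is their only common point. For $1\le k\le n$, $B(n,k)$ is the number of pairs of non-intersecting paths of length $n$ at distance $k$ from one another (Catalan's triangle; e.g. $B(1,1)=1$, $B(2,1)=2$, $B(2,2)=1$, and $B(n,1)$ is the Catalan number $\frac{1}{n+1}\binom{2n}{n}$). Equivalently, $B(n,k)=\frac{k}{n}\binom{2n}{n-k}$. Set $B(n,k)=0$ for $k>n$. -}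

module Defs where

open import Data.Nat using (ℕ; zero; suc; _+_; _*_; _∸_; _≤ᵇ_; NonZero)
open import Data.Nat.DivMod using (_/_)
open import Data.Nat.Combinatorics using (_C_)
open import Data.Bool using (if_then_else_)
open import Data.Integer using (ℤ; +_) renaming (_+_ to _+ℤ_; _-_ to _-ℤ_)

fib : ℕ → ℕ
fib zero = 0
fib (suc zero) = 1
fib (suc (suc n)) = fib (suc n) + fib n

-- Catalan's triangle: B(n,k) = (k/n) * binom(2n, n-k) for 1 ≤ k ≤ n, and 0 for k > n.
-- (The division is exact; for n ≥ 1 and k ≤ n.)  Argument n is used as n = suc m.
B : (n k : ℕ) → .{{NonZero n}} → ℕ
B n k = if k ≤ᵇ n then (k * ((2 * n) C (n ∸ k))) / n else 0

sumℤ : ℕ → (ℕ → ℤ) → ℤ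
sumℤ zero f = + 0
sumℤ (suc N) f = sumℤ N f +ℤ f N

-- The series Σ_{j ≥ 0} [B(n,5j+1) - B(n,5j+4)] truncated at j < n;
-- all terms with j ≥ n vanish since then 5j+1 > n.
seriesB : (n : ℕ) → .{{NonZero n}} → ℤ
seriesB n = sumℤ n (λ j → (+ B n (5 * j + 1)) -ℤ (+ B n (5 * j + 4)))

-- The rows of Catalan's triangle obey the two-step Pascal recurrence
-- B(n+1, k+1) = B(n, k) + 2 B(n, k+1) + B(n, k+2), and so does the ballot difference
-- C(2n−1, n−k) − C(2n−1, n−k−1); absorption turns the latter into (k/n) C(2n, n−k).
--
-- Pairing row n with a weight w, i.e. Σ_k w(k) B(n, k), and summing by parts moves the
-- recurrence onto the weight, w ↦ w(k+1) + 2 w(k) + w(k−1).  For the 5-periodic weights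
-- sign₁₄ (+1 at k ≡ 1, −1 at k ≡ 4) and sign₂₃ (+1 at k ≡ 2, −1 at k ≡ 3) this map is
-- sign₁₄ ↦ 2 sign₁₄ + sign₂₃ and sign₂₃ ↦ sign₁₄ + sign₂₃, the square of the Fibonacci matrix.
-- Since row 1 pairs to (1, 0) = (F₁, F₀), row n pairs to (F_{2n−1}, F_{2n−2}), and the pairing
-- with sign₁₄ is the series of the theorem.

module Submission where

open import Defs
open import Data.Bool using (true; false)
open import Data.Integer using (ℤ; +_; -[1+_]) renaming (_+_ to _+ℤ_; _-_ to _-ℤ_; _*_ to _*ℤ_)
import Data.Integer.Properties as ℤ
open import Data.Integer.Tactic.RingSolver using () renaming (solve-∀ to ℤ-solve-∀)
open import Data.Nat
open import Data.Nat.Combinatorics using (_C_; nCk+nC[k+1]≡[n+1]C[k+1]; nC1≡n; nCk≡nC[n∸k])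
open import Data.Nat.DivMod using (m*n/n≡m)
open import Data.Nat.Properties
open import Data.Nat.Tactic.RingSolver using () renaming (solve-∀ to ℕ-solve-∀)
open import Data.Product using (_×_; _,_; proj₁; proj₂)
open import Function using (_∘_)
open import Relation.Binary.PropositionalEquality
open import Relation.Nullary.Reflects using (ofʸ; ofⁿ)

-- N C[ a - b ] is N choose (a − b), taken to be 0 when b > a; note this is not N C (a ∸ b).
_C[_-_] : ℕ → ℕ → ℕ → ℕ
N C[ a     - zero  ] = N C a
N C[ zero  - suc b ] = 0
N C[ suc a - suc b ] = N C[ a - b ]

C[-]≡C∸ : ∀ N {a b} → b ≤ a → N C[ a - b ] ≡ N C (a ∸ b)
C[-]≡C∸ N z≤n       = refl
C[-]≡C∸ N (s≤s b≤a) = C[-]≡C∸ N b≤a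

C[-]-pascal : ∀ N a b → suc N C[ a - b ] ≡ N C[ a - b ] + N C[ a - suc b ]
C[-]-pascal N zero    zero    = refl
C[-]-pascal N (suc a) zero    = sym (trans (+-comm (N C suc a) (N C a)) (nCk+nC[k+1]≡[n+1]C[k+1] N a))
C[-]-pascal N zero    (suc b) = refl
C[-]-pascal N (suc a) (suc b) = C[-]-pascal N a b

C[-]-pascal² : ∀ N a b →
  suc (suc N) C[ a - b ] ≡ N C[ a - b ] + 2 * N C[ a - suc b ] + N C[ a - suc (suc b) ]
C[-]-pascal² N a b = begin
  suc (suc N) C[ a - b ]
    ≡⟨ C[-]-pascal (suc N) a b ⟩
  suc N C[ a - b ] + suc N C[ a - suc b ]
    ≡⟨ cong₂ _+_ (C[-]-pascal N a b) (C[-]-pascal N a (suc b)) ⟩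
  (N C[ a - b ] + N C[ a - suc b ]) + (N C[ a - suc b ] + N C[ a - suc (suc b) ])
    ≡⟨ collect (N C[ a - b ]) (N C[ a - suc b ]) (N C[ a - suc (suc b) ]) ⟩
  N C[ a - b ] + 2 * N C[ a - suc b ] + N C[ a - suc (suc b) ]
    ∎
  where
  open ≡-Reasoning
  collect : ∀ x y z → (x + y) + (y + z) ≡ x + 2 * y + z
  collect = ℕ-solve-∀

[k+1]*[n+1]C[k+1]≡[n+1]*nCk : ∀ n k → suc k * (suc n C suc k) ≡ suc n * (n C k)
[k+1]*[n+1]C[k+1]≡[n+1]*nCk zero    zero    = refl
[k+1]*[n+1]C[k+1]≡[n+1]*nCk zero    (suc k) = *-zeroʳ (suc (suc k))
[k+1]*[n+1]C[k+1]≡[n+1]*nCk (suc n) zero    = begin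
  1 * (suc (suc n) C 1) ≡⟨ *-identityˡ _ ⟩
  suc (suc n) C 1       ≡⟨ nC1≡n (suc (suc n)) ⟩
  suc (suc n)           ≡⟨ *-identityʳ (suc (suc n)) ⟨
  suc (suc n) * 1       ∎
  where open ≡-Reasoning
[k+1]*[n+1]C[k+1]≡[n+1]*nCk (suc n) (suc k) = begin
  suc (suc k) * (suc (suc n) C suc (suc k))
    ≡⟨ cong (suc (suc k) *_) (nCk+nC[k+1]≡[n+1]C[k+1] (suc n) (suc k)) ⟨
  suc (suc k) * (x + y)
    ≡⟨ split x y k ⟩
  x + (suc k * x + suc (suc k) * y)
    ≡⟨ cong₂ (λ u v → x + (u + v)) ([k+1]*[n+1]C[k+1]≡[n+1]*nCk n k)
                                   ([k+1]*[n+1]C[k+1]≡[n+1]*nCk n (suc k)) ⟩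
  x + (suc n * (n C k) + suc n * (n C suc k))
    ≡⟨ cong (_+_ x) (*-distribˡ-+ (suc n) (n C k) (n C suc k)) ⟨
  x + suc n * (n C k + n C suc k)
    ≡⟨ cong (λ z → x + suc n * z) (nCk+nC[k+1]≡[n+1]C[k+1] n k) ⟩
  suc (suc n) * x
    ∎
  where
  open ≡-Reasoning
  x = suc n C suc k
  y = suc n C suc (suc k)
  split : ∀ x y k → suc (suc k) * (x + y) ≡ x + (suc k * x + suc (suc k) * y)
  split = ℕ-solve-∀

C[-]-absorption : ∀ N a b → (a ∸ b) * (suc N C[ a - b ]) ≡ suc N * (N C[ a - suc b ])
C[-]-absorption N zero    zero    = sym (*-zeroʳ (suc N))
C[-]-absorption N (suc a) zero    = [k+1]*[n+1]C[k+1]≡[n+1]*nCk N a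
C[-]-absorption N zero    (suc b) = sym (*-zeroʳ (suc N))
C[-]-absorption N (suc a) (suc b) = C[-]-absorption N a b

-- catalan m k = B(m + 1, k): row m of this table is row n = m + 1 of Catalan's triangle.
catalan : ℕ → ℕ → ℕ
catalan zero    zero          = 0
catalan zero    (suc zero)    = 1
catalan zero    (suc (suc k)) = 0
catalan (suc m) zero          = 0
catalan (suc m) (suc k)       = catalan m k + 2 * catalan m (suc k) + catalan m (suc (suc k))

catalan-zero : ∀ m → catalan m 0 ≡ 0
catalan-zero zero    = refl
catalan-zero (suc m) = refl

catalan-vanishes : ∀ m {k} → suc m < k → catalan m k ≡ 0
catalan-vanishes zero    {suc zero}    (s≤s ())
catalan-vanishes zero    {suc (suc k)} _         = refl
catalan-vanishes (suc m) {suc k}       (s≤s m<k)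
  rewrite catalan-vanishes m m<k
        | catalan-vanishes m (m<n⇒m<1+n m<k)
        | catalan-vanishes m (m<n⇒m<1+n (m<n⇒m<1+n m<k)) = refl

binomial-symmetric : ∀ a b → (a + b) C a ≡ (a + b) C b
binomial-symmetric a b = trans (nCk≡nC[n∸k] (m≤m+n a b)) (cong ((a + b) C_) (m+n∸m≡n a b))

catalan-ballot : ∀ m k → catalan m k + (m + suc m) C[ m - k ] ≡ (m + suc m) C[ suc m - k ]
catalan-ballot zero    zero          = refl
catalan-ballot zero    (suc zero)    = refl
catalan-ballot zero    (suc (suc k)) = refl
catalan-ballot (suc m) zero          = binomial-symmetric (suc m) (suc (suc m))
catalan-ballot (suc m) (suc k) rewrite +-suc m (suc m) = begin
  (catalan m k + 2 * catalan m (suc k) + catalan m (suc (suc k))) + suc (suc N) C[ m - k ]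
    ≡⟨ cong (_+_ (catalan m k + 2 * catalan m (suc k) + catalan m (suc (suc k))))
            (C[-]-pascal² N m k) ⟩
  (catalan m k + 2 * catalan m (suc k) + catalan m (suc (suc k)))
    + (N C[ m - k ] + 2 * N C[ m - suc k ] + N C[ m - suc (suc k) ])
    ≡⟨ regroup (catalan m k) (catalan m (suc k)) (catalan m (suc (suc k)))
               (N C[ m - k ]) (N C[ m - suc k ]) (N C[ m - suc (suc k) ]) ⟩
  (catalan m k + N C[ m - k ]) + 2 * (catalan m (suc k) + N C[ m - suc k ])
    + (catalan m (suc (suc k)) + N C[ m - suc (suc k) ])
    ≡⟨ cong₃ (λ x y z → x + 2 * y + z)
             (catalan-ballot m k) (catalan-ballot m (suc k)) (catalan-ballot m (suc (suc k))) ⟩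
  N C[ suc m - k ] + 2 * N C[ suc m - suc k ] + N C[ suc m - suc (suc k) ]
    ≡⟨ C[-]-pascal² N (suc m) k ⟨
  suc (suc N) C[ suc m - k ]
    ∎
  where
  open ≡-Reasoning
  N = m + suc m
  regroup : ∀ x y z x′ y′ z′ →
    (x + 2 * y + z) + (x′ + 2 * y′ + z′) ≡ (x + x′) + 2 * (y + y′) + (z + z′)
  regroup = ℕ-solve-∀
  cong₃ : ∀ (f : ℕ → ℕ → ℕ → ℕ) {x x′ y y′ z z′} → x ≡ x′ → y ≡ y′ → z ≡ z′ → f x y z ≡ f x′ y′ z′
  cong₃ f refl refl refl = refl

catalan-closedForm : ∀ m {k} → k ≤ suc m →
  k * ((suc m + suc m) C[ suc m - k ]) ≡ suc m * catalan m k
catalan-closedForm m {k} k≤n = +-cancelʳ-≡ ((n + n) * c₀) _ _ (begin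
  k * X + (n + n) * c₀            ≡⟨ cong (_+_ (k * X)) (C[-]-absorption N n k) ⟨
  k * X + (n ∸ k) * X             ≡⟨ *-distribʳ-+ X k (n ∸ k) ⟨
  (k + (n ∸ k)) * X               ≡⟨ cong (_* X) (m+[n∸m]≡n k≤n) ⟩
  n * X                           ≡⟨ cong (n *_) (C[-]-pascal N n k) ⟩
  n * (c₁ + c₀)                   ≡⟨ cong (λ c → n * (c + c₀)) (catalan-ballot m k) ⟨
  n * (catalan m k + c₀ + c₀)     ≡⟨ expand n (catalan m k) c₀ ⟩
  n * catalan m k + (n + n) * c₀  ∎)
  where
  open ≡-Reasoning
  n = suc m
  N = m + suc m
  X = suc N C[ n - k ]
  c₀ = N C[ m - k ]
  c₁ = N C[ n - k ]
  expand : ∀ n c c₀ → n * (c + c₀ + c₀) ≡ n * c + (n + n) * c₀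
  expand = ℕ-solve-∀

B≡catalan : ∀ m k → B (suc m) k ≡ catalan m k
B≡catalan m k with k ≤ᵇ suc m | ≤ᵇ-reflects-≤ k (suc m)
... | false | ofⁿ k≰n = sym (catalan-vanishes m (≰⇒> k≰n))
... | true  | ofʸ k≤n = begin
  k * ((2 * suc m) C (suc m ∸ k)) / suc m       ≡⟨ cong (λ c → k * c / suc m) binomial ⟩
  k * ((suc m + suc m) C[ suc m - k ]) / suc m  ≡⟨ cong (_/ suc m) (catalan-closedForm m k≤n) ⟩
  suc m * catalan m k / suc m                   ≡⟨ cong (_/ suc m) (*-comm (suc m) (catalan m k)) ⟩
  catalan m k * suc m / suc m                   ≡⟨ m*n/n≡m (catalan m k) (suc m) ⟩
  catalan m k                                   ∎
  where
  open ≡-Reasoning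
  binomial : (2 * suc m) C (suc m ∸ k) ≡ (suc m + suc m) C[ suc m - k ]
  binomial = trans (cong (λ N → N C (suc m ∸ k)) (cong (_+_ (suc m)) (+-identityʳ (suc m))))
                   (sym (C[-]≡C∸ (suc m + suc m) k≤n))

sumℤ-cong : ∀ N {f g : ℕ → ℤ} → (∀ k → f k ≡ g k) → sumℤ N f ≡ sumℤ N g
sumℤ-cong zero    f≗g = refl
sumℤ-cong (suc N) f≗g = cong₂ _+ℤ_ (sumℤ-cong N f≗g) (f≗g N)

sumℤ-distrib-+ : ∀ N (f g : ℕ → ℤ) → sumℤ N (λ k → f k +ℤ g k) ≡ sumℤ N f +ℤ sumℤ N g
sumℤ-distrib-+ zero    f g = refl
sumℤ-distrib-+ (suc N) f g = begin
  sumℤ N (λ k → f k +ℤ g k) +ℤ (f N +ℤ g N)     ≡⟨ cong (_+ℤ (f N +ℤ g N)) (sumℤ-distrib-+ N f g) ⟩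
  sumℤ N f +ℤ sumℤ N g +ℤ (f N +ℤ g N)          ≡⟨ interchange (sumℤ N f) (sumℤ N g) (f N) (g N) ⟩
  sumℤ N f +ℤ f N +ℤ (sumℤ N g +ℤ g N)          ∎
  where
  open ≡-Reasoning
  interchange : ∀ a b c d → a +ℤ b +ℤ (c +ℤ d) ≡ a +ℤ c +ℤ (b +ℤ d)
  interchange = ℤ-solve-∀

sumℤ-distrib-+₃ : ∀ N (f g h : ℕ → ℤ) →
  sumℤ N (λ k → f k +ℤ (g k +ℤ h k)) ≡ sumℤ N f +ℤ (sumℤ N g +ℤ sumℤ N h)
sumℤ-distrib-+₃ N f g h =
  trans (sumℤ-distrib-+ N f _) (cong (sumℤ N f +ℤ_) (sumℤ-distrib-+ N g h))

sumℤ-head : ∀ N (f : ℕ → ℤ) → sumℤ (suc N) f ≡ f 0 +ℤ sumℤ N (f ∘ suc)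
sumℤ-head zero    f = trans (ℤ.+-identityˡ (f 0)) (sym (ℤ.+-identityʳ (f 0)))
sumℤ-head (suc N) f = trans (cong (_+ℤ f (suc N)) (sumℤ-head N f)) (ℤ.+-assoc (f 0) _ _)

sumℤ-shift : ∀ N (f : ℕ → ℤ) → f 0 ≡ + 0 → f N ≡ + 0 → sumℤ N f ≡ sumℤ N (f ∘ suc)
sumℤ-shift N f f0≡0 fN≡0 = begin
  sumℤ N f                      ≡⟨ ℤ.+-identityʳ (sumℤ N f) ⟨
  sumℤ N f +ℤ + 0               ≡⟨ cong (sumℤ N f +ℤ_) fN≡0 ⟨
  sumℤ (suc N) f                ≡⟨ sumℤ-head N f ⟩
  f 0 +ℤ sumℤ N (f ∘ suc)       ≡⟨ cong (_+ℤ sumℤ N (f ∘ suc)) f0≡0 ⟩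
  + 0 +ℤ sumℤ N (f ∘ suc)       ≡⟨ ℤ.+-identityˡ (sumℤ N (f ∘ suc)) ⟩
  sumℤ N (f ∘ suc)              ∎
  where open ≡-Reasoning

rowSum : (ℕ → ℤ) → ℕ → ℕ → ℤ
rowSum w m N = sumℤ N (λ k → w k *ℤ + catalan m k)

rowSum-+ : ∀ (w w′ : ℕ → ℤ) m N → rowSum (λ k → w k +ℤ w′ k) m N ≡ rowSum w m N +ℤ rowSum w′ m N
rowSum-+ w w′ m N =
  trans (sumℤ-cong N (λ k → ℤ.*-distribʳ-+ (+ catalan m k) (w k) (w′ k)))
        (sumℤ-distrib-+ N (λ k → w k *ℤ + catalan m k) (λ k → w′ k *ℤ + catalan m k))

rowSum-zero : ∀ w {N} → 1 < N → rowSum w 0 N ≡ w 1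
rowSum-zero w {suc zero}          (s≤s ())
rowSum-zero w {suc (suc zero)}    _             = begin
  + 0 +ℤ w 0 *ℤ + 0 +ℤ w 1 *ℤ + 1   ≡⟨ cong₂ (λ x y → + 0 +ℤ x +ℤ y) (ℤ.*-zeroʳ (w 0)) (ℤ.*-identityʳ (w 1)) ⟩
  + 0 +ℤ + 0 +ℤ w 1                 ≡⟨ ℤ.+-identityˡ (w 1) ⟩
  w 1                               ∎
  where open ≡-Reasoning
rowSum-zero w {suc (suc (suc N))} (s≤s (s≤s _)) = begin
  rowSum w 0 (suc (suc N)) +ℤ w (suc (suc N)) *ℤ + 0
    ≡⟨ cong (rowSum w 0 (suc (suc N)) +ℤ_) (ℤ.*-zeroʳ (w (suc (suc N)))) ⟩
  rowSum w 0 (suc (suc N)) +ℤ + 0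
    ≡⟨ ℤ.+-identityʳ _ ⟩
  rowSum w 0 (suc (suc N))
    ≡⟨ rowSum-zero w {suc (suc N)} (s≤s (s≤s z≤n)) ⟩
  w 1
    ∎
  where open ≡-Reasoning

catalan-suc-ℤ : ∀ m k →
  + catalan (suc m) (suc k) ≡ + catalan m k +ℤ + 2 *ℤ + catalan m (suc k) +ℤ + catalan m (suc (suc k))
catalan-suc-ℤ m k = begin
  + (x + 2 * y + z)           ≡⟨ ℤ.pos-+ (x + 2 * y) z ⟩
  + (x + 2 * y) +ℤ + z        ≡⟨ cong (_+ℤ + z) (ℤ.pos-+ x (2 * y)) ⟩
  + x +ℤ + (2 * y) +ℤ + z     ≡⟨ cong (λ t → + x +ℤ t +ℤ + z) (ℤ.pos-* 2 y) ⟩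
  + x +ℤ + 2 *ℤ + y +ℤ + z    ∎
  where
  open ≡-Reasoning
  x = catalan m k
  y = catalan m (suc k)
  z = catalan m (suc (suc k))

-- Summation by parts; every boundary term vanishes because row m is supported on 1, …, m + 1.
rowSum-suc : ∀ {w v : ℕ → ℤ} → w 0 ≡ + 0 →
  (∀ k → v (suc k) ≡ w (suc (suc k)) +ℤ + 2 *ℤ w (suc k) +ℤ w k) →
  ∀ m {N} → suc (suc m) < N → rowSum w (suc m) N ≡ rowSum v m N
rowSum-suc {w} {v} w0≡0 v-step m {N} m+2<N = begin
  rowSum w (suc m) N
    ≡⟨ sumℤ-shift N _ (ℤ.*-zeroʳ (w 0)) (vanishes (w N) (catalan-vanishes (suc m) m+2<N)) ⟩
  sumℤ N (λ k → w (suc k) *ℤ + catalan (suc m) (suc k))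
    ≡⟨ sumℤ-cong N (λ k → trans (cong (w (suc k) *ℤ_) (catalan-suc-ℤ m k))
                                (expand (w (suc k)) (c k) (c (suc k)) (c (suc (suc k))))) ⟩
  sumℤ N (λ k → w (suc k) *ℤ c k +ℤ (+ 2 *ℤ w (suc k) *ℤ c (suc k) +ℤ w (suc k) *ℤ c (suc (suc k))))
    ≡⟨ sumℤ-distrib-+₃ N _ _ _ ⟩
  sumℤ N (λ k → w (suc k) *ℤ c k) +ℤ (middle +ℤ sumℤ N (λ k → w (suc k) *ℤ c (suc (suc k))))
    ≡⟨ cong₂ (λ a b → a +ℤ (middle +ℤ b))
             (sumℤ-shift N _ (vanishes (w 1) (catalan-zero m))
                             (vanishes (w (suc N)) (catalan-vanishes m m+1<N)))
             (sym (sumℤ-shift N _ (cong (_*ℤ c 1) w0≡0)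
                                  (vanishes (w N) (catalan-vanishes m (m<n⇒m<1+n m+1<N))))) ⟩
  sumℤ N (λ k → w (suc (suc k)) *ℤ c (suc k)) +ℤ (middle +ℤ sumℤ N (λ k → w k *ℤ c (suc k)))
    ≡⟨ sumℤ-distrib-+₃ N _ _ _ ⟨
  sumℤ N (λ k → w (suc (suc k)) *ℤ c (suc k) +ℤ (+ 2 *ℤ w (suc k) *ℤ c (suc k) +ℤ w k *ℤ c (suc k)))
    ≡⟨ sumℤ-cong N (λ k → trans (collect (w (suc (suc k))) (w (suc k)) (w k) (c (suc k)))
                                (cong (_*ℤ c (suc k)) (sym (v-step k)))) ⟩
  sumℤ N (λ k → v (suc k) *ℤ c (suc k))
    ≡⟨ sumℤ-shift N _ (vanishes (v 0) (catalan-zero m))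
                      (vanishes (v N) (catalan-vanishes m m+1<N)) ⟨
  rowSum v m N
    ∎
  where
  open ≡-Reasoning
  c : ℕ → ℤ
  c k = + catalan m k
  m+1<N : suc m < N
  m+1<N = <-trans (n<1+n (suc m)) m+2<N
  middle = sumℤ N (λ k → + 2 *ℤ w (suc k) *ℤ c (suc k))
  vanishes : ∀ (x : ℤ) {n} → n ≡ 0 → x *ℤ + n ≡ + 0
  vanishes x refl = ℤ.*-zeroʳ x
  expand : ∀ a x y z → a *ℤ (x +ℤ + 2 *ℤ y +ℤ z) ≡ a *ℤ x +ℤ (+ 2 *ℤ a *ℤ y +ℤ a *ℤ z)
  expand = ℤ-solve-∀
  collect : ∀ a b d y → a *ℤ y +ℤ (+ 2 *ℤ b *ℤ y +ℤ d *ℤ y) ≡ (a +ℤ + 2 *ℤ b +ℤ d) *ℤ y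
  collect = ℤ-solve-∀

sign₁₄ sign₂₃ : ℕ → ℤ
sign₁₄ 0 = + 0
sign₁₄ 1 = + 1
sign₁₄ 2 = + 0
sign₁₄ 3 = + 0
sign₁₄ 4 = -[1+ 0 ]
sign₁₄ (suc (suc (suc (suc (suc k))))) = sign₁₄ k
sign₂₃ 0 = + 0
sign₂₃ 1 = + 0
sign₂₃ 2 = + 1
sign₂₃ 3 = -[1+ 0 ]
sign₂₃ 4 = + 0
sign₂₃ (suc (suc (suc (suc (suc k))))) = sign₂₃ k

sign₁₄-step : ∀ k → sign₁₄ (suc k) +ℤ sign₁₄ (suc k) +ℤ sign₂₃ (suc k)
                  ≡ sign₁₄ (suc (suc k)) +ℤ + 2 *ℤ sign₁₄ (suc k) +ℤ sign₁₄ k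
sign₁₄-step 0 = refl
sign₁₄-step 1 = refl
sign₁₄-step 2 = refl
sign₁₄-step 3 = refl
sign₁₄-step 4 = refl
sign₁₄-step (suc (suc (suc (suc (suc k))))) = sign₁₄-step k

sign₂₃-step : ∀ k → sign₁₄ (suc k) +ℤ sign₂₃ (suc k)
                  ≡ sign₂₃ (suc (suc k)) +ℤ + 2 *ℤ sign₂₃ (suc k) +ℤ sign₂₃ k
sign₂₃-step 0 = refl
sign₂₃-step 1 = refl
sign₂₃-step 2 = refl
sign₂₃-step 3 = refl
sign₂₃-step 4 = refl
sign₂₃-step (suc (suc (suc (suc (suc k))))) = sign₂₃-step k

rowSum-signs : ∀ m {N} → suc m < N →
  rowSum sign₁₄ m N ≡ + fib (suc (m + m)) × rowSum sign₂₃ m N ≡ + fib (m + m)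
rowSum-signs zero    1<N = rowSum-zero sign₁₄ 1<N , rowSum-zero sign₂₃ 1<N
rowSum-signs (suc m) {N} m+2<N = odd , even
  where
  open ≡-Reasoning
  a = fib (suc (m + m))
  b = fib (m + m)
  IH = rowSum-signs m (<-trans (n<1+n (suc m)) m+2<N)
  rearrange : ∀ x y → x +ℤ x +ℤ y ≡ x +ℤ y +ℤ x
  rearrange = ℤ-solve-∀
  fib-indices : suc m + suc m ≡ suc (suc (m + m))
  fib-indices = cong suc (+-suc m m)
  odd : rowSum sign₁₄ (suc m) N ≡ + fib (suc (suc m + suc m))
  odd = begin
    rowSum sign₁₄ (suc m) N
      ≡⟨ rowSum-suc {sign₁₄} {λ k → sign₁₄ k +ℤ sign₁₄ k +ℤ sign₂₃ k} refl sign₁₄-step m m+2<N ⟩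
    rowSum (λ k → sign₁₄ k +ℤ sign₁₄ k +ℤ sign₂₃ k) m N
      ≡⟨ trans (rowSum-+ (λ k → sign₁₄ k +ℤ sign₁₄ k) sign₂₃ m N)
               (cong (_+ℤ rowSum sign₂₃ m N) (rowSum-+ sign₁₄ sign₁₄ m N)) ⟩
    rowSum sign₁₄ m N +ℤ rowSum sign₁₄ m N +ℤ rowSum sign₂₃ m N
      ≡⟨ cong₂ (λ x y → x +ℤ x +ℤ y) (proj₁ IH) (proj₂ IH) ⟩
    + a +ℤ + a +ℤ + b
      ≡⟨ rearrange (+ a) (+ b) ⟩
    + a +ℤ + b +ℤ + a
      ≡⟨ trans (cong (_+ℤ + a) (ℤ.pos-+ a b)) (ℤ.pos-+ (a + b) a) ⟨
    + fib (suc (suc (suc (m + m))))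
      ≡⟨ cong (+_ ∘ fib ∘ suc) fib-indices ⟨
    + fib (suc (suc m + suc m))
      ∎
  even : rowSum sign₂₃ (suc m) N ≡ + fib (suc m + suc m)
  even = begin
    rowSum sign₂₃ (suc m) N
      ≡⟨ rowSum-suc {sign₂₃} {λ k → sign₁₄ k +ℤ sign₂₃ k} refl sign₂₃-step m m+2<N ⟩
    rowSum (λ k → sign₁₄ k +ℤ sign₂₃ k) m N
      ≡⟨ rowSum-+ sign₁₄ sign₂₃ m N ⟩
    rowSum sign₁₄ m N +ℤ rowSum sign₂₃ m N
      ≡⟨ cong₂ _+ℤ_ (proj₁ IH) (proj₂ IH) ⟩
    + a +ℤ + b
      ≡⟨ ℤ.pos-+ a b ⟨
    + fib (suc (suc (m + m)))
      ≡⟨ cong (+_ ∘ fib) fib-indices ⟨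
    + fib (suc m + suc m)
      ∎

sumℤ-split : ∀ n X (f : ℕ → ℤ) → sumℤ (n + X) f ≡ sumℤ X f +ℤ sumℤ n (λ r → f (r + X))
sumℤ-split zero    X f = sym (ℤ.+-identityʳ (sumℤ X f))
sumℤ-split (suc n) X f = trans (cong (_+ℤ f (n + X)) (sumℤ-split n X f)) (ℤ.+-assoc (sumℤ X f) _ _)

sumℤ-blocks : ∀ n N (f : ℕ → ℤ) → sumℤ (n * N) f ≡ sumℤ N (λ j → sumℤ n (λ r → f (r + n * j)))
sumℤ-blocks n zero    f = cong (λ X → sumℤ X f) (*-zeroʳ n)
sumℤ-blocks n (suc N) f = begin
  sumℤ (n * suc N) f
    ≡⟨ cong (λ X → sumℤ X f) (*-suc n N) ⟩
  sumℤ (n + n * N) f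
    ≡⟨ sumℤ-split n (n * N) f ⟩
  sumℤ (n * N) f +ℤ sumℤ n (λ r → f (r + n * N))
    ≡⟨ cong (_+ℤ sumℤ n (λ r → f (r + n * N))) (sumℤ-blocks n N f) ⟩
  sumℤ N (λ j → sumℤ n (λ r → f (r + n * j))) +ℤ sumℤ n (λ r → f (r + n * N))
    ∎
  where open ≡-Reasoning

sign₁₄-periodic : ∀ j r → sign₁₄ (r + 5 * j) ≡ sign₁₄ r
sign₁₄-periodic zero    r = cong sign₁₄ (+-identityʳ r)
sign₁₄-periodic (suc j) r = begin
  sign₁₄ (r + 5 * suc j)   ≡⟨ cong sign₁₄ (+-comm r (5 * suc j)) ⟩
  sign₁₄ (5 * suc j + r)   ≡⟨ cong (λ X → sign₁₄ (X + r)) (*-suc 5 j) ⟩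
  sign₁₄ (5 * j + r)       ≡⟨ cong sign₁₄ (+-comm (5 * j) r) ⟩
  sign₁₄ (r + 5 * j)       ≡⟨ sign₁₄-periodic j r ⟩
  sign₁₄ r                 ∎
  where open ≡-Reasoning

sign₁₄-block : ∀ j (h : ℕ → ℤ) →
  sumℤ 5 (λ r → sign₁₄ (r + 5 * j) *ℤ h (r + 5 * j)) ≡ h (5 * j + 1) -ℤ h (5 * j + 4)
sign₁₄-block j h = begin
  sumℤ 5 (λ r → sign₁₄ (r + X) *ℤ h (r + X))
    ≡⟨ sumℤ-cong 5 (λ r → cong (_*ℤ h (r + X)) (sign₁₄-periodic j r)) ⟩
  sumℤ 5 (λ r → sign₁₄ r *ℤ h (r + X))
    ≡⟨ evaluate (h X) (h (1 + X)) (h (2 + X)) (h (3 + X)) (h (4 + X)) ⟩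
  h (1 + X) -ℤ h (4 + X)
    ≡⟨ cong₂ (λ a b → h a -ℤ h b) (+-comm 1 X) (+-comm 4 X) ⟩
  h (X + 1) -ℤ h (X + 4)
    ∎
  where
  open ≡-Reasoning
  X = 5 * j
  evaluate : ∀ a b c d e →
    + 0 +ℤ + 0 *ℤ a +ℤ + 1 *ℤ b +ℤ + 0 *ℤ c +ℤ + 0 *ℤ d +ℤ -[1+ 0 ] *ℤ e ≡ b -ℤ e
  evaluate = ℤ-solve-∀

mainTheorem5 : (m : ℕ) → + fib (2 * suc m ∸ 1) ≡ seriesB (suc m)
mainTheorem5 m = begin
  + fib (2 * suc m ∸ 1)
    ≡⟨ cong (+_ ∘ fib) (trans (cong (_+_ m) (+-identityʳ (suc m))) (+-suc m m)) ⟩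
  + fib (suc (m + m))
    ≡⟨ proj₁ (rowSum-signs m n<5n) ⟨
  rowSum sign₁₄ m (5 * suc m)
    ≡⟨ sumℤ-blocks 5 (suc m) _ ⟩
  sumℤ (suc m) (λ j → sumℤ 5 (λ r → sign₁₄ (r + 5 * j) *ℤ + catalan m (r + 5 * j)))
    ≡⟨ sumℤ-cong (suc m) (λ j → sign₁₄-block j (+_ ∘ catalan m)) ⟩
  sumℤ (suc m) (λ j → + catalan m (5 * j + 1) -ℤ + catalan m (5 * j + 4))
    ≡⟨ sumℤ-cong (suc m) (λ j → cong₂ (λ x y → + x -ℤ + y)
                                      (B≡catalan m (5 * j + 1)) (B≡catalan m (5 * j + 4))) ⟨
  seriesB (suc m)
    ∎
  where
  open ≡-Reasoning
  n<5n : suc m < 5 * suc m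
  n<5n = subst (suc m <_) (*-comm (suc m) 5) (m<m*n (suc m) 5 (s≤s (s≤s z≤n)))
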